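{- Let $K$ be a commutative semiring, $A$ a finite alphabet, $X$ a finite set and $(o,\delta):X\to K\times\mathcal{T}_K(X)^A$ a syntactic system of equations, with assignment $\mathbf{mu}$ as defined below. Then the relation $R=\{(t,t')\mid t\in\mathcal{T}_K(X),\ t'\in\mathcal{T}_\mu,\ t'\text{ is a closure of }t\text{ with respect to }\mathbf{mu}\}$ is a bisimulation up to bisimilarity between the coalgebra $(\mathcal{T}_K(X),(\bar o,\bar\delta))$ and the coalgebra $\mathcal{T}_\mu$ of closed $\mu$-expressions.
   Context: $\mathcal{T}_K(X)$: terms $\tau::=\bar k\ (k\in K)\mid\bar x\ (x\in X)\mid\bar a\ (a\in A)\mid\tau+\tau\mid\tau\times\tau$; write $x_a=\delta(x)(a)$. Extension $(\bar o,\bar\delta)$ (write $\tau_a$): $\bar o(\bar x)=o(x)$, $\bar x_a=x_a$; $\bar o(\bar k)=k$, $\bar k_a=\bar 0$; $\bar o(\bar b)=0$, $\bar b_a=\bar 1$ if $b=a$ else $\bar 0$; $\bar o(\sigma+\upsilon)=\bar o(\sigma)+\bar o(\upsilon)$, $(\sigma+\upsilon)_a=\sigma_a+\upsilon_a$; $\bar o(\sigma\times\upsilon)=\bar o(\sigma)\bar o(\upsilon)$, $(\sigma\times\upsilon)_a=(\sigma_a\times\upsilon)+(\overline{\bar o(\sigma)}\times\upsilon_a)$. $\mu$-expressions over variables (containing $X$): $t::=\bar k\mid x\mid\bar a\mid t+t\mid t\times t\mid\mu x.g$, guarded $g::=\bar a\times t\mid\bar k\mid g+g$; $\mathcal{T}_K(X)$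 is viewed as the $\mu$-free expressions by identifying $\bar x$ with $x$. $\mathcal{T}_\mu$ (closed expressions) is a $K\times(-)^A$-coalgebra: $o(\bar k)=k$, $\bar k_a=\bar 0$; $o(\bar b)=0$, $\bar b_a=\bar 1$ if $b=a$ else $\bar 0$; $o(u+v)=o(u)+o(v)$, $(u+v)_a=u_a+v_a$; $o(u\times v)=o(u)o(v)$, $(u\times v)_a=(u_a\times v)+(\overline{o(u)}\times v_a)$; $o(\mu x.u)=o(u[\mu x.u/x])$, $(\mu x.u)_a=(u[\mu x.u/x])_a$ (substitution for free occurrences). $\mathbf{mu}(x):=\overline{o(x)}+\sum_{a\in A}(\bar a\times x_a)$, the sum formed in a fixed total order of $A$ with a fixed bracketing. Single syntactic substitution of $t$ from $x$ w.r.t. an assignment $\phi$: (1) $t=x$, $t'=\mu x.\phi(x)$; or $t'$ arises by applying such a substitution inside one argument of $+$ or $\times$, or inside the body of $\mu y.u$ (the replaced occurrence need not be free). $t'$ is obtainable from $t$ if there is a finite chain $t=t_0,\dots,t_{n-1}=t'$ ($n\ge1$), each a single syntactic substitution of the previous from some variable; a closure of $t$ is an obtainable $t'$ with no free variables. For $K\times(-)^A$-coalgebras $P,Q$ with bisimilarity $\sim$ (largest relation $S$ with $pSq\Rightarrow o(p)=o(q)$ and $p_aSq_a$), $R\subseteq P\times Q$ is a bisimulation up to bisimilarity if whenever $pRq$: $o(p)=o(q)$ and for every $a\in A$ there are $p'\in P$, $q'\in Q$ with $p_a\sim p'$, $p'Rq'$, $q'\sim q_a$.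
   Formalization: In the coalgebra $\mathcal{T}_\mu$, unfolding $\mu x.u$ gives each summand $\bar b\times t$ of the body output 0 and a-derivative $(\bar b_a\times t)+\bar 0$ in place of $o(\bar b)o(t)$ and $(\bar b_a\times t)+(\overline{o(\bar b)}\times t_a)$. Apart from conventions, each condition added here is assumed in the paper as well or is needed for the statement above to hold. -}

module Defs where

open import Level using (Level; _⊔_) renaming (suc to lsuc)
open import Data.Nat using (ℕ)
open import Data.Fin using (Fin)
open import Data.Fin.Properties using () renaming (_≟_ to _≟F_)
open import Data.Bool using (if_then_else_)
open import Data.List using (foldl; allFin)
open import Data.Product using (Σ; ∃; ∃₂; _×_; _,_; proj₁)
open import Data.Sum using (_⊎_; inj₁; inj₂)
open import Relation.Nullary using (¬_; yes; no; does)
open import Relation.Binary.Core using (Rel; REL)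
open import Relation.Binary.Definitions using (DecidableEquality)
open import Relation.Binary.PropositionalEquality using (_≡_; _≢_; refl; subst)
open import Relation.Binary.Construct.Closure.ReflexiveTransitive using (Star)
open import Algebra.Bundles using (CommutativeSemiring)

module Coalgebras {c ℓ} (K : CommutativeSemiring c ℓ) (n : ℕ) where
  open CommutativeSemiring K using (Carrier; _≈_)

  record Coalg : Set (lsuc c) where
    field
      St  : Set c
      out : St → Carrier
      der : St → Fin n → St

  module _ (C : Coalg) where
    open Coalg C

    IsBisimulation : Rel St (c ⊔ ℓ) → Set (c ⊔ ℓ)
    IsBisimulation S = ∀ {p q} → S p q → (out p ≈ out q) × (∀ a → S (der p a) (der q a))

    Bisimilar : Rel St (lsuc (c ⊔ ℓ))
    Bisimilar p q = Σ (Rel St (c ⊔ ℓ)) λ S → IsBisimulation S × S p q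

  IsBisimUpToBisim : ∀ {r} (P Q : Coalg) → REL (Coalg.St P) (Coalg.St Q) r → Set (lsuc (c ⊔ ℓ) ⊔ r)
  IsBisimUpToBisim P Q R =
    ∀ {p q} → R p q →
      (Coalg.out P p ≈ Coalg.out Q q) ×
      (∀ a → ∃₂ λ p' q' → Bisimilar P (Coalg.der P p a) p' × R p' q' × Bisimilar Q q' (Coalg.der Q q a))

-- Syntax.  X = Fin m, A = Fin n, the set of variables V contains X via ι.

module Setup {c ℓ} (K : CommutativeSemiring c ℓ) (n m : ℕ)
             (V : Set) (_≟V_ : DecidableEquality V) (ι : Fin m → V) where
  open CommutativeSemiring K using (Carrier; _≈_; _+_; _*_; 0#; 1#)
  open Coalgebras K n public

  data TK : Set c where
    tk  : Carrier → TK
    tx  : Fin m → TK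
    ta  : Fin n → TK
    _t+_ : TK → TK → TK
    _t×_ : TK → TK → TK

  mutual
    data Term : Set c where
      con  : Carrier → Term
      var  : V → Term
      lit  : Fin n → Term
      _+ₜ_ : Term → Term → Term
      _×ₜ_ : Term → Term → Term
      μ    : V → Guarded → Term

    data Guarded : Set c where
      pre  : Fin n → Term → Guarded
      gcon : Carrier → Guarded
      _⊕_  : Guarded → Guarded → Guarded

  -- T_K(X) viewed as μ-free expressions (x̄ identified with x)
  embed : TK → Term
  embed (tk k) = con k
  embed (tx x) = var (ι x)
  embed (ta a) = lit a
  embed (σ t+ υ) = embed σ +ₜ embed υ
  embed (σ t× υ) = embed σ ×ₜ embed υ

  mutual
    data _∈FV_ (v : V) : Term → Set c where
      var : v ∈FV var v
      +l  : ∀ {t u} → v ∈FV t → v ∈FV (t +ₜ u)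
      +r  : ∀ {t u} → v ∈FV u → v ∈FV (t +ₜ u)
      ×l  : ∀ {t u} → v ∈FV t → v ∈FV (t ×ₜ u)
      ×r  : ∀ {t u} → v ∈FV u → v ∈FV (t ×ₜ u)
      μ   : ∀ {y g} → v ≢ y → v ∈FVG g → v ∈FV μ y g

    data _∈FVG_ (v : V) : Guarded → Set c where
      pre : ∀ {a t} → v ∈FV t → v ∈FVG pre a t
      ⊕l  : ∀ {g h} → v ∈FVG g → v ∈FVG (g ⊕ h)
      ⊕r  : ∀ {g h} → v ∈FVG h → v ∈FVG (g ⊕ h)

  Closed : Term → Set c
  Closed t = ∀ v → ¬ (v ∈FV t)

  mutual
    sub : Term → V → Term → Term
    sub s x (con k) = con k
    sub s x (var y) with y ≟V x
    ... | yes _ = s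
    ... | no _ = var y
    sub s x (lit a) = lit a
    sub s x (t +ₜ u) = sub s x t +ₜ sub s x u
    sub s x (t ×ₜ u) = sub s x t ×ₜ sub s x u
    sub s x (μ y g) with y ≟V x
    ... | yes _ = μ y g
    ... | no _ = μ y (subG s x g)

    subG : Term → V → Guarded → Guarded
    subG s x (pre a t) = pre a (sub s x t)
    subG s x (gcon k) = gcon k
    subG s x (g ⊕ h) = subG s x g ⊕ subG s x h

  letterDer : Fin n → Fin n → Carrier
  letterDer b a = if does (b ≟F a) then 1# else 0#

  outG : Guarded → Carrier
  outG (pre a t) = 0#
  outG (gcon k) = k
  outG (g ⊕ h) = outG g + outG h

  outT : Term → Carrier
  outT (con k) = k
  outT (var v) = 0#            -- irrelevant: never used on closed terms
  outT (lit b) = 0#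
  outT (t +ₜ u) = outT t + outT u
  outT (t ×ₜ u) = outT t * outT u
  outT (μ y g) = outG g        -- = o(g[μy.g/y]) with o(b̄ × t) = 0

  -- (g[s/y])_a for guarded g
  derG : Fin n → V → Term → Guarded → Term
  derG a y s (pre b t) = (con (letterDer b a) ×ₜ sub s y t) +ₜ con 0#
  derG a y s (gcon k) = con 0#
  derG a y s (g ⊕ h) = derG a y s g +ₜ derG a y s h

  derT : Term → Fin n → Term
  derT (con k) a = con 0#
  derT (var v) a = con 0#      -- irrelevant: never used on closed terms
  derT (lit b) a = con (letterDer b a)
  derT (t +ₜ u) a = derT t a +ₜ derT u a
  derT (t ×ₜ u) a = (derT t a ×ₜ u) +ₜ (con (outT t) ×ₜ derT u a)
  derT (μ y g) a = derG a y (μ y g) g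

  mutual
    sub-fv : ∀ {v} s x t → v ∈FV sub s x t → (v ∈FV s) ⊎ ((v ≢ x) × (v ∈FV t))
    sub-fv s x (con k) ()
    sub-fv s x (var y) p with y ≟V x
    ... | yes _ = inj₁ p
    sub-fv s x (var y) var | no y≢x = inj₂ (y≢x , var)
    sub-fv s x (lit a) ()
    sub-fv s x (t +ₜ u) (+l p) with sub-fv s x t p
    ... | inj₁ q = inj₁ q
    ... | inj₂ (ne , q) = inj₂ (ne , +l q)
    sub-fv s x (t +ₜ u) (+r p) with sub-fv s x u p
    ... | inj₁ q = inj₁ q
    ... | inj₂ (ne , q) = inj₂ (ne , +r q)
    sub-fv s x (t ×ₜ u) (×l p) with sub-fv s x t p
    ... | inj₁ q = inj₁ q
    ... | inj₂ (ne , q) = inj₂ (ne , ×l q)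
    sub-fv s x (t ×ₜ u) (×r p) with sub-fv s x u p
    ... | inj₁ q = inj₁ q
    ... | inj₂ (ne , q) = inj₂ (ne , ×r q)
    sub-fv s x (μ y g) p with y ≟V x
    sub-fv s x (μ y g) (μ v≢y q) | yes refl = inj₂ (v≢y , μ v≢y q)
    sub-fv s x (μ y g) (μ v≢y q) | no _ with subG-fv s x g q
    ... | inj₁ r = inj₁ r
    ... | inj₂ (ne , r) = inj₂ (ne , μ v≢y r)

    subG-fv : ∀ {v} s x g → v ∈FVG subG s x g → (v ∈FV s) ⊎ ((v ≢ x) × (v ∈FVG g))
    subG-fv s x (pre a t) (pre p) with sub-fv s x t p
    ... | inj₁ q = inj₁ q
    ... | inj₂ (ne , q) = inj₂ (ne , pre q)
    subG-fv s x (gcon k) ()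
    subG-fv s x (g ⊕ h) (⊕l p) with subG-fv s x g p
    ... | inj₁ q = inj₁ q
    ... | inj₂ (ne , q) = inj₂ (ne , ⊕l q)
    subG-fv s x (g ⊕ h) (⊕r p) with subG-fv s x h p
    ... | inj₁ q = inj₁ q
    ... | inj₂ (ne , q) = inj₂ (ne , ⊕r q)

  derG-fv : ∀ {v} a y s g → v ∈FV derG a y s g → (v ∈FV s) ⊎ ((v ≢ y) × (v ∈FVG g))
  derG-fv a y s (pre b t) (+l (×l ()))
  derG-fv a y s (pre b t) (+l (×r p)) with sub-fv s y t p
  ... | inj₁ q = inj₁ q
  ... | inj₂ (ne , q) = inj₂ (ne , pre q)
  derG-fv a y s (pre b t) (+r ())
  derG-fv a y s (gcon k) ()
  derG-fv a y s (g ⊕ h) (+l p) with derG-fv a y s g p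
  ... | inj₁ q = inj₁ q
  ... | inj₂ (ne , q) = inj₂ (ne , ⊕l q)
  derG-fv a y s (g ⊕ h) (+r p) with derG-fv a y s h p
  ... | inj₁ q = inj₁ q
  ... | inj₂ (ne , q) = inj₂ (ne , ⊕r q)

  derT-fv : ∀ {v} t a → v ∈FV derT t a → v ∈FV t
  derT-fv (con k) a ()
  derT-fv (var x) a ()
  derT-fv (lit b) a ()
  derT-fv (t +ₜ u) a (+l p) = +l (derT-fv t a p)
  derT-fv (t +ₜ u) a (+r p) = +r (derT-fv u a p)
  derT-fv (t ×ₜ u) a (+l (×l p)) = ×l (derT-fv t a p)
  derT-fv (t ×ₜ u) a (+l (×r p)) = ×r p
  derT-fv (t ×ₜ u) a (+r (×l ()))
  derT-fv (t ×ₜ u) a (+r (×r p)) = ×r (derT-fv u a p)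
  derT-fv (μ y g) a p with derG-fv a y (μ y g) g p
  ... | inj₁ q = q
  ... | inj₂ (ne , q) = μ ne q

  Tμ : Coalg
  Tμ = record
    { St  = Σ Term Closed
    ; out = λ t → outT (proj₁ t)
    ; der = λ { (t , cl) a → derT t a , (λ v p → cl v (derT-fv t a p)) }
    }

  module _ (φ : Fin m → Guarded) where
    mutual
      data SingleSubst (x : Fin m) : Term → Term → Set c where
        here : SingleSubst x (var (ι x)) (μ (ι x) (φ x))
        +l   : ∀ {t t' u} → SingleSubst x t t' → SingleSubst x (t +ₜ u) (t' +ₜ u)
        +r   : ∀ {t u u'} → SingleSubst x u u' → SingleSubst x (t +ₜ u) (t +ₜ u')
        ×l   : ∀ {t t' u} → SingleSubst x t t' → SingleSubst x (t ×ₜ u) (t' ×ₜ u)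
        ×r   : ∀ {t u u'} → SingleSubst x u u' → SingleSubst x (t ×ₜ u) (t ×ₜ u')
        inμ  : ∀ {y g g'} → SingleSubstG x g g' → SingleSubst x (μ y g) (μ y g')

      data SingleSubstG (x : Fin m) : Guarded → Guarded → Set c where
        pre : ∀ {a t t'} → SingleSubst x t t' → SingleSubstG x (pre a t) (pre a t')
        ⊕l  : ∀ {g g' h} → SingleSubstG x g g' → SingleSubstG x (g ⊕ h) (g' ⊕ h)
        ⊕r  : ∀ {g h h'} → SingleSubstG x h h' → SingleSubstG x (g ⊕ h) (g ⊕ h')

    Obtainable : Term → Term → Set c
    Obtainable = Star (λ t t' → ∃ λ x → SingleSubst x t t')

    IsClosureOf : Term → Term → Set c
    IsClosureOf t' t = Obtainable t t' × Closed t'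

  module System (o : Fin m → Carrier) (δ : Fin m → Fin n → TK) where

    outTK : TK → Carrier
    outTK (tk k) = k
    outTK (tx x) = o x
    outTK (ta b) = 0#
    outTK (σ t+ υ) = outTK σ + outTK υ
    outTK (σ t× υ) = outTK σ * outTK υ

    derTK : TK → Fin n → TK
    derTK (tk k) a = tk 0#
    derTK (tx x) a = δ x a
    derTK (ta b) a = tk (letterDer b a)
    derTK (σ t+ υ) a = derTK σ a t+ derTK υ a
    derTK (σ t× υ) a = (derTK σ a t× υ) t+ (tk (outTK σ) t× derTK υ a)

    TKCoalg : Coalg
    TKCoalg = record { St = TK ; out = outTK ; der = derTK }

    mu : Fin m → Guarded
    mu x = foldl (λ acc a → acc ⊕ pre a (embed (δ x a))) (gcon (o x)) (allFin n)

    R : TK → Σ Term Closed → Set c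
    R τ t' = IsClosureOf mu (proj₁ t') (embed τ)

{-# OPTIONS --safe #-}
-- A closure t of τ arises by replacing each variable x̄ of τ by some μx.g, where g is in
-- turn obtained from mu(x); this structural description is what the induction runs on.
-- By induction on τ, o(t) = ō(τ), and the a-derivative of t equals a closure of τ_a up to
-- the unit and zero laws of K: for τ = x̄ the summand ā × x_a of mu(x) unfolds to a closure
-- of x_a while every other summand contributes 0̄.  Expressions equal up to these laws are
-- bisimilar, so one may take p' = τ_a and q' that closure.
module Submission where

open import Defs
open import Data.Nat using (ℕ)
open import Data.Fin using (Fin)
open import Relation.Binary.PropositionalEquality using (_≡_)
open import Relation.Binary.Definitions using (DecidableEquality)
open import Function.Definitions using (Injective)
open import Algebra.Bundles using (CommutativeSemiring)

open import Level using (Lift; lift; _⊔_)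
open import Function using (_∘_)
open import Data.Fin.Properties using () renaming (_≟_ to _≟F_)
open import Data.List using (List; []; _∷_; foldl; foldr; reverse; allFin)
open import Data.List.Properties using (foldl-ʳ++; reverse-involutive)
open import Data.List.Membership.Propositional using (_∈_; _∉_)
open import Data.List.Membership.Propositional.Properties using (∈-allFin)
open import Data.List.Relation.Unary.Any using (here; there)
open import Data.List.Relation.Unary.Any.Properties using (reverse⁺)
open import Data.List.Relation.Unary.All using (lookup)
open import Data.List.Relation.Unary.All.Properties using (All¬⇒¬Any)
open import Data.List.Relation.Unary.AllPairs using (_∷_)
open import Data.List.Relation.Unary.Unique.Propositional using (Unique)
open import Data.List.Relation.Unary.Unique.Propositional.Properties using (allFin⁺)
import Data.List.Relation.Binary.Permutation.Setoid as Permutation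
import Data.List.Relation.Binary.Permutation.Setoid.Properties as PermutationProperties
open import Data.Product using (Σ; _×_; _,_; proj₁; map₂)
open import Data.Sum using (inj₁; inj₂)
open import Data.Empty using (⊥-elim)
open import Relation.Nullary using (¬_; yes; no)
open import Relation.Nullary.Decidable using (dec-true; dec-false)
open import Relation.Binary.PropositionalEquality
  using (_≢_; refl; sym; cong; cong₂; subst; setoid; module ≡-Reasoning)
import Relation.Binary.Reasoning.Setoid
open import Relation.Binary.Construct.Closure.ReflexiveTransitive
  using (Star; ε; _◅_; _◅◅_; gmap; fold)

Unique-reverse : ∀ {a} {A : Set a} {xs : List A} → Unique xs → Unique (reverse xs)
Unique-reverse {A = A} {xs} = Unique-resp-↭ (↭-sym (↭-reverse xs))
  where
  open Permutation (setoid A) using (↭-sym)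
  open PermutationProperties (setoid A) using (Unique-resp-↭; ↭-reverse)

module _ {c ℓ} (K : CommutativeSemiring c ℓ) (n : ℕ) where
  open Coalgebras K n

  Bisimilar-refl : ∀ (C : Coalg) {p} → Bisimilar C p p
  Bisimilar-refl C = S , isBisimulation , lift refl
    where
    open CommutativeSemiring K using () renaming (refl to ≈-refl)
    S : _ → _ → Set (c ⊔ ℓ)
    S p q = Lift ℓ (p ≡ q)
    isBisimulation : IsBisimulation C S
    isBisimulation (lift refl) = ≈-refl , λ _ → lift refl

module Expressions {c ℓ} (K : CommutativeSemiring c ℓ) (n m : ℕ)
    (V : Set) (_≟V_ : DecidableEquality V) (ι : Fin m → V) where

  open Setup K n m V _≟V_ ι
  open CommutativeSemiring K using (Carrier; _≈_; _+_; 0#; 1#; +-cong; *-cong;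
    +-identityˡ; +-identityʳ; *-identityˡ; zeroˡ)
    renaming (refl to ≈-refl; sym to ≈-sym; trans to ≈-trans; reflexive to ≈-reflexive)
  module ≈-Reasoning = Relation.Binary.Reasoning.Setoid (CommutativeSemiring.setoid K)

  -- Only the unit and zero laws produced by derivatives of products and of guarded bodies.
  infix 4 _≃_
  data _≃_ : Term → Term → Set (c ⊔ ℓ) where
    ≃-refl       : ∀ {t} → t ≃ t
    ≃-sym        : ∀ {t u} → t ≃ u → u ≃ t
    ≃-trans      : ∀ {t u v} → t ≃ u → u ≃ v → t ≃ v
    +ₜ-cong      : ∀ {t t' u u'} → t ≃ t' → u ≃ u' → t +ₜ u ≃ t' +ₜ u'
    ×ₜ-cong      : ∀ {t t' u u'} → t ≃ t' → u ≃ u' → t ×ₜ u ≃ t' ×ₜ u'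
    con-cong     : ∀ {k k'} → k ≈ k' → con k ≃ con k'
    +ₜ-identityˡ : ∀ {z t} → z ≈ 0# → con z +ₜ t ≃ t
    +ₜ-identityʳ : ∀ {z t} → z ≈ 0# → t +ₜ con z ≃ t
    ×ₜ-identityˡ : ∀ {z t} → z ≈ 1# → con z ×ₜ t ≃ t
    ×ₜ-zeroˡ     : ∀ {z t} → z ≈ 0# → con z ×ₜ t ≃ con 0#

  ≃-outT : ∀ {t u} → t ≃ u → outT t ≈ outT u
  ≃-outT ≃-refl = ≈-refl
  ≃-outT (≃-sym p) = ≈-sym (≃-outT p)
  ≃-outT (≃-trans p q) = ≈-trans (≃-outT p) (≃-outT q)
  ≃-outT (+ₜ-cong p q) = +-cong (≃-outT p) (≃-outT q)
  ≃-outT (×ₜ-cong p q) = *-cong (≃-outT p) (≃-outT q)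
  ≃-outT (con-cong e) = e
  ≃-outT (+ₜ-identityˡ e) = ≈-trans (+-cong e ≈-refl) (+-identityˡ _)
  ≃-outT (+ₜ-identityʳ e) = ≈-trans (+-cong ≈-refl e) (+-identityʳ _)
  ≃-outT (×ₜ-identityˡ e) = ≈-trans (*-cong e ≈-refl) (*-identityˡ _)
  ≃-outT (×ₜ-zeroˡ e) = ≈-trans (*-cong e ≈-refl) (zeroˡ _)

  ≃-derT : ∀ {t u} → t ≃ u → ∀ a → derT t a ≃ derT u a
  ≃-derT ≃-refl a = ≃-refl
  ≃-derT (≃-sym p) a = ≃-sym (≃-derT p a)
  ≃-derT (≃-trans p q) a = ≃-trans (≃-derT p a) (≃-derT q a)
  ≃-derT (+ₜ-cong p q) a = +ₜ-cong (≃-derT p a) (≃-derT q a)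
  ≃-derT (×ₜ-cong p q) a =
    +ₜ-cong (×ₜ-cong (≃-derT p a) q) (×ₜ-cong (con-cong (≃-outT p)) (≃-derT q a))
  ≃-derT (con-cong e) a = ≃-refl
  ≃-derT (+ₜ-identityˡ e) a = +ₜ-identityˡ ≈-refl
  ≃-derT (+ₜ-identityʳ e) a = +ₜ-identityʳ ≈-refl
  ≃-derT (×ₜ-identityˡ e) a = ≃-trans (+ₜ-cong (×ₜ-zeroˡ ≈-refl) (×ₜ-identityˡ e)) (+ₜ-identityˡ ≈-refl)
  ≃-derT (×ₜ-zeroˡ e) a = ≃-trans (+ₜ-cong (×ₜ-zeroˡ ≈-refl) (×ₜ-zeroˡ e)) (+ₜ-identityˡ ≈-refl)

  ≃⇒Bisimilar : ∀ {p q : Σ Term Closed} → proj₁ p ≃ proj₁ q → Bisimilar Tμ p q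
  ≃⇒Bisimilar p≃q = (λ p q → proj₁ p ≃ proj₁ q) , (λ r → ≃-outT r , ≃-derT r) , p≃q

  letterDer-≡ : ∀ a → letterDer a a ≡ 1#
  letterDer-≡ a rewrite dec-true (a ≟F a) refl = refl

  letterDer-≢ : ∀ {b a} → b ≢ a → letterDer b a ≡ 0#
  letterDer-≢ {b} {a} b≢a rewrite dec-false (b ≟F a) b≢a = refl

  derG-pre-≡ : ∀ {a y s t} → derG a y s (pre a t) ≃ sub s y t
  derG-pre-≡ {a} = ≃-trans (+ₜ-identityʳ ≈-refl) (×ₜ-identityˡ (≈-reflexive (letterDer-≡ a)))

  derG-pre-≢ : ∀ {a b y s t} → b ≢ a → derG a y s (pre b t) ≃ con 0#
  derG-pre-≢ b≢a = ≃-trans (+ₜ-identityʳ ≈-refl) (×ₜ-zeroˡ (≈-reflexive (letterDer-≢ b≢a)))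

  sub-closed : ∀ {s y t} → Closed s → (∀ v → v ≢ y → ¬ v ∈FV t) → Closed (sub s y t)
  sub-closed {s} {y} {t} cl-s fv-t v p with sub-fv s y t p
  ... | inj₁ v∈s = cl-s v v∈s
  ... | inj₂ (v≢y , v∈t) = fv-t v v≢y v∈t

  Closed-con : ∀ {k} → Closed (con k)
  Closed-con v ()

  Closed-+ₜ⁺ : ∀ {t u} → Closed t → Closed u → Closed (t +ₜ u)
  Closed-+ₜ⁺ cl-t cl-u v (+l p) = cl-t v p
  Closed-+ₜ⁺ cl-t cl-u v (+r p) = cl-u v p

  Closed-×ₜ⁺ : ∀ {t u} → Closed t → Closed u → Closed (t ×ₜ u)
  Closed-×ₜ⁺ cl-t cl-u v (×l p) = cl-t v p
  Closed-×ₜ⁺ cl-t cl-u v (×r p) = cl-u v p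

  Closed-+ₜ⁻ : ∀ {t u} → Closed (t +ₜ u) → Closed t × Closed u
  Closed-+ₜ⁻ cl = (λ v p → cl v (+l p)) , (λ v p → cl v (+r p))

  Closed-×ₜ⁻ : ∀ {t u} → Closed (t ×ₜ u) → Closed t × Closed u
  Closed-×ₜ⁻ cl = (λ v p → cl v (×l p)) , (λ v p → cl v (×r p))

  prefixSum : Guarded → List (Fin n) → (Fin n → Term) → Guarded
  prefixSum g₀ bs u = foldr (λ b g → g ⊕ pre b (u b)) g₀ bs

  outG-prefixSum : ∀ {k} bs u → outG (prefixSum (gcon k) bs u) ≈ k
  outG-prefixSum [] u = ≈-refl
  outG-prefixSum (b ∷ bs) u = ≈-trans (+-identityʳ _) (outG-prefixSum bs u)

  module Unfolding (φ : Fin m → Guarded) where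

    -- Obtainable φ in structural form.  The equation v ≡ ι x in ⇝unfold spares
    -- pattern matching from having to unify ι x with ι z.
    mutual
      infix 4 _⇝_ _⇝ᴳ_
      data _⇝_ : Term → Term → Set c where
        ⇝var    : ∀ {v} → var v ⇝ var v
        ⇝unfold : ∀ {v} x {g} → v ≡ ι x → φ x ⇝ᴳ g → var v ⇝ μ v g
        ⇝con    : ∀ {k} → con k ⇝ con k
        ⇝lit    : ∀ {b} → lit b ⇝ lit b
        ⇝+      : ∀ {t t' u u'} → t ⇝ t' → u ⇝ u' → t +ₜ u ⇝ t' +ₜ u'
        ⇝×      : ∀ {t t' u u'} → t ⇝ t' → u ⇝ u' → t ×ₜ u ⇝ t' ×ₜ u'
        ⇝μ      : ∀ {y g g'} → g ⇝ᴳ g' → μ y g ⇝ μ y g'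

      data _⇝ᴳ_ : Guarded → Guarded → Set c where
        ⇝pre  : ∀ {b t t'} → t ⇝ t' → pre b t ⇝ᴳ pre b t'
        ⇝gcon : ∀ {k} → gcon k ⇝ᴳ gcon k
        ⇝⊕    : ∀ {g g' h h'} → g ⇝ᴳ g' → h ⇝ᴳ h' → g ⊕ h ⇝ᴳ g' ⊕ h'

    mutual
      ⇝-refl : ∀ t → t ⇝ t
      ⇝-refl (con k) = ⇝con
      ⇝-refl (var v) = ⇝var
      ⇝-refl (lit b) = ⇝lit
      ⇝-refl (t +ₜ u) = ⇝+ (⇝-refl t) (⇝-refl u)
      ⇝-refl (t ×ₜ u) = ⇝× (⇝-refl t) (⇝-refl u)
      ⇝-refl (μ y g) = ⇝μ (⇝ᴳ-refl g)

      ⇝ᴳ-refl : ∀ g → g ⇝ᴳ g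
      ⇝ᴳ-refl (pre b t) = ⇝pre (⇝-refl t)
      ⇝ᴳ-refl (gcon k) = ⇝gcon
      ⇝ᴳ-refl (g ⊕ h) = ⇝⊕ (⇝ᴳ-refl g) (⇝ᴳ-refl h)

    mutual
      SingleSubst-⇝ : ∀ {x t t₁ t₂} → SingleSubst φ x t t₁ → t₁ ⇝ t₂ → t ⇝ t₂
      SingleSubst-⇝ here (⇝μ g) = ⇝unfold _ refl g
      SingleSubst-⇝ (+l s) (⇝+ p q) = ⇝+ (SingleSubst-⇝ s p) q
      SingleSubst-⇝ (+r s) (⇝+ p q) = ⇝+ p (SingleSubst-⇝ s q)
      SingleSubst-⇝ (×l s) (⇝× p q) = ⇝× (SingleSubst-⇝ s p) q
      SingleSubst-⇝ (×r s) (⇝× p q) = ⇝× p (SingleSubst-⇝ s q)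
      SingleSubst-⇝ (inμ s) (⇝μ g) = ⇝μ (SingleSubstG-⇝ᴳ s g)

      SingleSubstG-⇝ᴳ : ∀ {x g g₁ g₂} → SingleSubstG φ x g g₁ → g₁ ⇝ᴳ g₂ → g ⇝ᴳ g₂
      SingleSubstG-⇝ᴳ (pre s) (⇝pre p) = ⇝pre (SingleSubst-⇝ s p)
      SingleSubstG-⇝ᴳ (⊕l s) (⇝⊕ p q) = ⇝⊕ (SingleSubstG-⇝ᴳ s p) q
      SingleSubstG-⇝ᴳ (⊕r s) (⇝⊕ p q) = ⇝⊕ p (SingleSubstG-⇝ᴳ s q)

    Obtainable⇒⇝ : ∀ {t t'} → Obtainable φ t t' → t ⇝ t'
    Obtainable⇒⇝ = fold _⇝_ (λ (_ , s) → SingleSubst-⇝ s) (⇝-refl _)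

    ObtainableG : Guarded → Guarded → Set c
    ObtainableG = Star (λ g g' → Σ (Fin m) λ x → SingleSubstG φ x g g')

    mutual
      ⇝⇒Obtainable : ∀ {t t'} → t ⇝ t' → Obtainable φ t t'
      ⇝⇒Obtainable ⇝var = ε
      ⇝⇒Obtainable (⇝unfold x refl g) =
        (x , here) ◅ gmap (μ (ι x)) (map₂ inμ) (⇝ᴳ⇒ObtainableG g)
      ⇝⇒Obtainable ⇝con = ε
      ⇝⇒Obtainable ⇝lit = ε
      ⇝⇒Obtainable (⇝+ {t' = t'} {u = u} p q) =
        gmap (_+ₜ u) (map₂ +l) (⇝⇒Obtainable p) ◅◅ gmap (t' +ₜ_) (map₂ +r) (⇝⇒Obtainable q)
      ⇝⇒Obtainable (⇝× {t' = t'} {u = u} p q) =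
        gmap (_×ₜ u) (map₂ ×l) (⇝⇒Obtainable p) ◅◅ gmap (t' ×ₜ_) (map₂ ×r) (⇝⇒Obtainable q)
      ⇝⇒Obtainable (⇝μ {y = y} g) = gmap (μ y) (map₂ inμ) (⇝ᴳ⇒ObtainableG g)

      ⇝ᴳ⇒ObtainableG : ∀ {g g'} → g ⇝ᴳ g' → ObtainableG g g'
      ⇝ᴳ⇒ObtainableG (⇝pre {b = b} p) = gmap (pre b) (map₂ pre) (⇝⇒Obtainable p)
      ⇝ᴳ⇒ObtainableG ⇝gcon = ε
      ⇝ᴳ⇒ObtainableG (⇝⊕ {g' = g'} {h = h} p q) =
        gmap (_⊕ h) (map₂ ⊕l) (⇝ᴳ⇒ObtainableG p) ◅◅ gmap (g' ⊕_) (map₂ ⊕r) (⇝ᴳ⇒ObtainableG q)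

    mutual
      sub-⇝ : ∀ {y s t t₁} → var y ⇝ s → t ⇝ t₁ → t ⇝ sub s y t₁
      sub-⇝ {y} y⇝s (⇝var {v}) with v ≟V y
      ... | yes refl = y⇝s
      ... | no _ = ⇝var
      sub-⇝ {y} y⇝s (⇝unfold {v} x e g) with v ≟V y
      ... | yes _ = ⇝unfold x e g
      ... | no _ = ⇝unfold x e (subG-⇝ᴳ y⇝s g)
      sub-⇝ y⇝s ⇝con = ⇝con
      sub-⇝ y⇝s ⇝lit = ⇝lit
      sub-⇝ y⇝s (⇝+ p q) = ⇝+ (sub-⇝ y⇝s p) (sub-⇝ y⇝s q)
      sub-⇝ y⇝s (⇝× p q) = ⇝× (sub-⇝ y⇝s p) (sub-⇝ y⇝s q)
      sub-⇝ {y} y⇝s (⇝μ {y = y'} g) with y' ≟V y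
      ... | yes _ = ⇝μ g
      ... | no _ = ⇝μ (subG-⇝ᴳ y⇝s g)

      subG-⇝ᴳ : ∀ {y s g g₁} → var y ⇝ s → g ⇝ᴳ g₁ → g ⇝ᴳ subG s y g₁
      subG-⇝ᴳ y⇝s (⇝pre p) = ⇝pre (sub-⇝ y⇝s p)
      subG-⇝ᴳ y⇝s ⇝gcon = ⇝gcon
      subG-⇝ᴳ y⇝s (⇝⊕ p q) = ⇝⊕ (subG-⇝ᴳ y⇝s p) (subG-⇝ᴳ y⇝s q)

    ⇝ᴳ-outG : ∀ {g g'} → g ⇝ᴳ g' → outG g ≡ outG g'
    ⇝ᴳ-outG (⇝pre p) = refl
    ⇝ᴳ-outG ⇝gcon = refl
    ⇝ᴳ-outG (⇝⊕ p q) = cong₂ _+_ (⇝ᴳ-outG p) (⇝ᴳ-outG q)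

    closed-⇝-var : Injective _≡_ _≡_ ι → ∀ {x t} → var (ι x) ⇝ t → Closed t →
                   Σ Guarded λ g → t ≡ μ (ι x) g × φ x ⇝ᴳ g
    closed-⇝-var ι-inj ⇝var cl = ⊥-elim (cl _ var)
    closed-⇝-var ι-inj (⇝unfold z e g) _ with ι-inj e
    ... | refl = _ , refl , g

    derG-prefixSum-∉ : ∀ {a y s k} bs u {g} → a ∉ bs → prefixSum (gcon k) bs u ⇝ᴳ g →
                       derG a y s g ≃ con 0#
    derG-prefixSum-∉ [] u a∉bs ⇝gcon = ≃-refl
    derG-prefixSum-∉ {y = y} {s} (b ∷ bs) u a∉bs (⇝⊕ g (⇝pre {t' = t} _)) =
      ≃-trans (+ₜ-cong (derG-prefixSum-∉ {y = y} {s} bs u (a∉bs ∘ there) g)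
                       (derG-pre-≢ {t = t} (a∉bs ∘ here ∘ sym)))
              (+ₜ-identityˡ ≈-refl)

    derG-prefixSum-∈ : ∀ {a y s k} bs u {g} → Unique bs → a ∈ bs → prefixSum (gcon k) bs u ⇝ᴳ g →
                       Σ Term λ t → u a ⇝ t × (∀ {v} → v ∈FV t → v ∈FVG g) × derG a y s g ≃ sub s y t
    derG-prefixSum-∈ {a} {y} {s} (_ ∷ bs) u (b∉bs ∷ _) (here refl) (⇝⊕ g (⇝pre {t' = t} p)) =
      t , p , (λ v∈t → ⊕r (pre v∈t)) ,
      ≃-trans (+ₜ-cong (derG-prefixSum-∉ {y = y} {s} bs u (All¬⇒¬Any b∉bs) g) (derG-pre-≡ {a} {t = t}))
              (+ₜ-identityˡ ≈-refl)
    derG-prefixSum-∈ {y = y} {s} (_ ∷ bs) u (b∉bs ∷ unique) (there a∈bs) (⇝⊕ g (⇝pre {t' = t'} _))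
      with t , p , fv , d ← derG-prefixSum-∈ {y = y} {s} bs u unique a∈bs g =
      t , p , (λ v∈t → ⊕l (fv v∈t)) ,
      ≃-trans (+ₜ-cong d (derG-pre-≢ {t = t'} (lookup b∉bs a∈bs))) (+ₜ-identityʳ ≈-refl)

  module Closures (ι-inj : Injective _≡_ _≡_ ι)
                  (o : Fin m → Carrier) (δ : Fin m → Fin n → TK) where
    open System o δ
    open Unfolding mu

    -- mu x is a left fold; as a right fold over the reversed alphabet its outermost
    -- summand becomes accessible to structural recursion.
    mu≡prefixSum : ∀ x → mu x ≡ prefixSum (gcon (o x)) (reverse (allFin n)) (embed ∘ δ x)
    mu≡prefixSum x = begin
      foldl f (gcon (o x)) (allFin n)
        ≡⟨ cong (foldl f (gcon (o x))) (sym (reverse-involutive (allFin n))) ⟩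
      foldl f (gcon (o x)) (reverse (reverse (allFin n)))
        ≡⟨ foldl-ʳ++ f (gcon (o x)) (reverse (allFin n)) ⟩
      prefixSum (gcon (o x)) (reverse (allFin n)) (embed ∘ δ x)
        ∎
      where
      open ≡-Reasoning
      f : Guarded → Fin n → Guarded
      f g b = g ⊕ pre b (embed (δ x b))

    mu-outG : ∀ {x g} → mu x ⇝ᴳ g → outG g ≈ o x
    mu-outG {x} {g} mu⇝g = begin
      outG g
        ≡⟨ sym (⇝ᴳ-outG mu⇝g) ⟩
      outG (mu x)
        ≡⟨ cong outG (mu≡prefixSum x) ⟩
      outG (prefixSum (gcon (o x)) (reverse (allFin n)) (embed ∘ δ x))
        ≈⟨ outG-prefixSum (reverse (allFin n)) (embed ∘ δ x) ⟩
      o x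
        ∎
      where open ≈-Reasoning

    mu-derG : ∀ {x g} → mu x ⇝ᴳ g → ∀ a {y s} →
              Σ Term λ t → embed (δ x a) ⇝ t × (∀ {v} → v ∈FV t → v ∈FVG g) × derG a y s g ≃ sub s y t
    mu-derG {x} mu⇝g a =
      derG-prefixSum-∈ (reverse (allFin n)) (embed ∘ δ x)
        (Unique-reverse (allFin⁺ n)) (reverse⁺ (∈-allFin a)) (subst (_⇝ᴳ _) (mu≡prefixSum x) mu⇝g)

    ClosureUpTo : TK → Term → Set (c ⊔ ℓ)
    ClosureUpTo τ t = Σ Term λ q → Closed q × embed τ ⇝ q × q ≃ t

    unfold-derT : ∀ {x g} → mu x ⇝ᴳ g → Closed (μ (ι x) g) → ∀ a →
                  ClosureUpTo (δ x a) (derT (μ (ι x) g) a)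
    unfold-derT {x} {g} mu⇝g cl a with t , δxa⇝t , fv , d ← mu-derG mu⇝g a {ι x} {μ (ι x) g} =
      sub (μ (ι x) g) (ι x) t ,
      sub-closed cl (λ v v≢ιx v∈t → cl v (μ v≢ιx (fv v∈t))) ,
      sub-⇝ (⇝unfold x refl mu⇝g) δxa⇝t ,
      ≃-sym d

    ⇝-outT : ∀ τ {t} → embed τ ⇝ t → Closed t → outTK τ ≈ outT t
    ⇝-outT (tk k) ⇝con _ = ≈-refl
    ⇝-outT (tx x) x⇝t cl with closed-⇝-var ι-inj x⇝t cl
    ... | _ , refl , mu⇝g = ≈-sym (mu-outG mu⇝g)
    ⇝-outT (ta b) ⇝lit _ = ≈-refl
    ⇝-outT (σ t+ υ) (⇝+ p q) cl with cl₁ , cl₂ ← Closed-+ₜ⁻ cl =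
      +-cong (⇝-outT σ p cl₁) (⇝-outT υ q cl₂)
    ⇝-outT (σ t× υ) (⇝× p q) cl with cl₁ , cl₂ ← Closed-×ₜ⁻ cl =
      *-cong (⇝-outT σ p cl₁) (⇝-outT υ q cl₂)

    ⇝-derT : ∀ τ {t} → embed τ ⇝ t → Closed t → ∀ a → ClosureUpTo (derTK τ a) (derT t a)
    ⇝-derT (tk k) ⇝con _ a = con 0# , Closed-con , ⇝con , ≃-refl
    ⇝-derT (tx x) x⇝t cl a with closed-⇝-var ι-inj x⇝t cl
    ... | _ , refl , mu⇝g = unfold-derT mu⇝g cl a
    ⇝-derT (ta b) ⇝lit _ a = con (letterDer b a) , Closed-con , ⇝con , ≃-refl
    ⇝-derT (σ t+ υ) (⇝+ p q) cl a
      with cl₁ , cl₂ ← Closed-+ₜ⁻ cl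
      with q₁ , cl-q₁ , σ⇝q₁ , d₁ ← ⇝-derT σ p cl₁ a
      with q₂ , cl-q₂ , υ⇝q₂ , d₂ ← ⇝-derT υ q cl₂ a =
      q₁ +ₜ q₂ , Closed-+ₜ⁺ cl-q₁ cl-q₂ , ⇝+ σ⇝q₁ υ⇝q₂ , +ₜ-cong d₁ d₂
    ⇝-derT (σ t× υ) {_ ×ₜ u} (⇝× p q) cl a
      with cl₁ , cl₂ ← Closed-×ₜ⁻ cl
      with q₁ , cl-q₁ , σ⇝q₁ , d₁ ← ⇝-derT σ p cl₁ a
      with q₂ , cl-q₂ , υ⇝q₂ , d₂ ← ⇝-derT υ q cl₂ a =
      (q₁ ×ₜ u) +ₜ (con (outTK σ) ×ₜ q₂) ,
      Closed-+ₜ⁺ (Closed-×ₜ⁺ cl-q₁ cl₂) (Closed-×ₜ⁺ Closed-con cl-q₂) ,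
      ⇝+ (⇝× σ⇝q₁ q) (⇝× ⇝con υ⇝q₂) ,
      +ₜ-cong (×ₜ-cong d₁ ≃-refl) (×ₜ-cong (con-cong (⇝-outT σ p cl₁)) d₂)

    closure-isBisimUpToBisim : IsBisimUpToBisim TKCoalg Tμ R
    closure-isBisimUpToBisim {τ} {t , cl} (t-obtainable , _) =
      ⇝-outT τ τ⇝t cl , λ a →
        let q , cl-q , τₐ⇝q , q≃tₐ = ⇝-derT τ τ⇝t cl a
        in derTK τ a , (q , cl-q) ,
           Bisimilar-refl K n TKCoalg ,
           (⇝⇒Obtainable τₐ⇝q , cl-q) ,
           ≃⇒Bisimilar {q , cl-q} {Coalg.der Tμ (t , cl) a} q≃tₐ
      where
      τ⇝t : embed τ ⇝ t
      τ⇝t = Obtainable⇒⇝ t-obtainable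

proposition6p8 : ∀ {c ℓ} (K : CommutativeSemiring c ℓ) (n m : ℕ)
    (V : Set) (_≟V_ : DecidableEquality V) (ι : Fin m → V) → Injective _≡_ _≡_ ι →
    (o : Fin m → CommutativeSemiring.Carrier K) (δ : Fin m → Fin n → Setup.TK K n m V _≟V_ ι) →
    Setup.IsBisimUpToBisim K n m V _≟V_ ι
      (Setup.System.TKCoalg K n m V _≟V_ ι o δ)
      (Setup.Tμ K n m V _≟V_ ι)
      (Setup.System.R K n m V _≟V_ ι o δ)
proposition6p8 K n m V _≟V_ ι ι-inj o δ {τ} {t} =
  Expressions.Closures.closure-isBisimUpToBisim K n m V _≟V_ ι ι-inj o δ {τ} {t}
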